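{- There exists an oriented graph $H$ which is Tur\'anable but which is not a subgraph of $D_s$ for any $s \in \mathbb{N}$.
   Context: An oriented graph is a directed graph with no loops in which, for every pair of distinct vertices $u,v$, at most one of the ordered edges $uv$, $vu$ is present; a tournament is an oriented graph in which exactly one of them is present for every pair. For a vertex $v$, $d^+(v)$ and $d^-(v)$ are its out- and in-degree, and the minimum semi-degree $\delta^0(G)$ is the minimum over all vertices of all in- and out-degrees. A regular tournament is a tournament on an odd number $n$ of vertices with $\delta^0 = (n-1)/2$. An oriented graph $H$ is Tur\'anable if there exists $n_0$ such that every regular tournament on $n \ge n_0$ vertices contains a copy of $H$ (as a subgraph). For integers $s \ge 1$, $D_s$ is the tournament on $3s$ vertices with vertex set partitioned into three sets $A,B,C$ of size $s$, each inducing a transitive tournament, with all edges between distinct parts oriented from $A$ to $B$, from $B$ to $C$, and from $C$ to $A$. -}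

module Defs where

open import Data.Nat using (ℕ; zero; suc; _+_; _*_; _⊓_; _≤_; _<_)
open import Data.Fin using (Fin; zero; suc; remQuot; toℕ)
open import Data.Bool using (Bool; true; false; if_then_else_)
open import Data.Product using (Σ; ∃; ∃-syntax; _×_; _,_; proj₁; proj₂)
open import Data.Sum using (_⊎_)
open import Relation.Binary.PropositionalEquality using (_≡_; _≢_)
open import Function.Definitions using (Injective)

Digraph : ℕ → Set
Digraph n = Fin n → Fin n → Bool

Oriented : ∀ {n} → Digraph n → Set
Oriented {n} E = (∀ (u : Fin n) → E u u ≡ false)
               × (∀ (u v : Fin n) → E u v ≡ true → E v u ≡ false)

Tournament : ∀ {n} → Digraph n → Set
Tournament {n} E = Oriented E
                 × (∀ (u v : Fin n) → u ≢ v → (E u v ≡ true) ⊎ (E v u ≡ true))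

count : ∀ {n} → (Fin n → Bool) → ℕ
count {zero}  p = 0
count {suc n} p = (if p zero then 1 else 0) + count (λ i → p (suc i))

outdeg : ∀ {n} → Digraph n → Fin n → ℕ
outdeg E v = count (λ u → E v u)

indeg : ∀ {n} → Digraph n → Fin n → ℕ
indeg E v = count (λ u → E u v)

minFin : ∀ {m} → (Fin (suc m) → ℕ) → ℕ
minFin {zero}  f = f zero
minFin {suc m} f = f zero ⊓ minFin (λ i → f (suc i))

-- minimum semi-degree δ⁰ (the empty graph, never used below, gets 0)
δ⁰ : ∀ {n} → Digraph n → ℕ
δ⁰ {zero}  E = 0
δ⁰ {suc m} E = minFin (λ v → outdeg E v ⊓ indeg E v)

RegularTournament : ∀ {n} → Digraph n → Set
RegularTournament {n} E = Tournament E × (∃[ k ] (n ≡ suc (k + k) × δ⁰ E ≡ k))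

_⊆G_ : ∀ {h n} → Digraph h → Digraph n → Set
_⊆G_ {h} {n} H G = Σ (Fin h → Fin n) λ f →
  Injective _≡_ _≡_ f × (∀ (u v : Fin h) → H u v ≡ true → G (f u) (f v) ≡ true)

Turanable : ∀ {h} → Digraph h → Set
Turanable H = ∃[ n₀ ] (∀ (n : ℕ) → n₀ ≤ n → (G : Digraph n) →
                RegularTournament G → H ⊆G G)

next3 : Fin 3 → Fin 3
next3 zero = suc zero
next3 (suc zero) = suc (suc zero)
next3 (suc (suc zero)) = zero

eq3 : Fin 3 → Fin 3 → Bool
eq3 zero zero = true
eq3 (suc zero) (suc zero) = true
eq3 (suc (suc zero)) (suc (suc zero)) = true
eq3 _ _ = false

lt? : ℕ → ℕ → Bool
lt? _ zero = false
lt? zero (suc _) = true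
lt? (suc a) (suc b) = lt? a b

-- D_s on vertex set Fin (3 * s); vertex x lies in part proj₁ (remQuot s x)
-- (0 = A, 1 = B, 2 = C) with index proj₂ (remQuot s x) ∈ Fin s inside its part.
-- Inside a part: transitive tournament (edge from smaller to larger index).
-- Between parts: A → B, B → C, C → A.
D : (s : ℕ) → Digraph (3 * s)
D s x y with remQuot {3} s x | remQuot {3} s y
... | (p , i) | (q , j) =
  if eq3 p q then lt? (toℕ i) (toℕ j) else eq3 (next3 p) q

{-# OPTIONS --safe #-}
-- H is the transitive triangle 0 → 1 → 2, 0 → 2 whose edges 01 and 12 are
-- completed to cyclic triangles 0 → 1 → 4 → 0 and 1 → 2 → 3 → 1.
--
-- Every edge of D_s stays inside its part (going up in the transitive order)
-- or moves on to the cyclically next part.  Around a cyclic triangle the part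
-- thus advances 0 or 3 times, and not 0 times as the parts are transitive;
-- hence the parts of 0, 1, 2 would be p, p + 1, p + 2, leaving no room for
-- the edge 0 → 2.
--
-- In a regular tournament on 2k + 1 vertices every edge uw lies in a cyclic
-- triangle: otherwise N⁻(u) ∪ {u} ⊆ N⁻(w), so d⁻(w) ≥ k + 1 and
-- d⁺(w) + d⁻(w) ≥ 2k + 1.  For k ≥ 2 two out-neighbours of a vertex span a
-- transitive triangle, and completing two of its edges gives a copy of H.
-- The copy is injective because any two vertices of H are joined by a
-- directed path of length at most two, which an oriented graph cannot close.
module Submission where

open import Defs
open import Data.Nat using (ℕ; _≤_)
open import Data.Product using (Σ; ∃; ∃-syntax; _×_)
open import Relation.Nullary using (¬_)

open import Data.Bool using (Bool; true; false; if_then_else_; _∧_; _∨_)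
import Data.Bool.Properties as Bool
open import Data.Empty using (⊥-elim)
open import Data.Fin using (Fin; zero; suc; remQuot; toℕ)
open import Data.Fin.Patterns using (0F; 1F; 2F; 3F; 4F)
open import Data.Fin.Properties using (_≟_; suc-injective; any?; all?)
open import Data.List using (List; []; _∷_)
open import Data.List.Relation.Unary.All using (All; []; _∷_)
open import Data.Nat using (zero; suc; _+_; _*_; _<_; z≤n; s≤s; s≤s⁻¹)
open import Data.Nat.Properties
  using ( ≤-refl; ≤-reflexive; ≤-trans; ≤-<-trans; <-trans; <-asym; ≤⇒≯; +-suc
        ; +-mono-≤; +-mono-≤-<; m⊓n≤m; m⊓n≤n)
open import Data.Product using (∃₂; _,_; proj₁; proj₂)
open import Data.Sum using (_⊎_; inj₁; inj₂)
open import Function using (_∘_)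
open import Function.Definitions using (Injective)
open import Relation.Binary.PropositionalEquality
  using (_≡_; _≢_; refl; sym; trans; cong; cong₂; subst)
open import Relation.Nullary using (Dec; yes; no)
open import Relation.Nullary.Decidable
  using (⌊_⌋; from-yes; ¬?; _⊎-dec_; _×-dec_; _→-dec_)

true≢false : true ≢ false
true≢false ()

indicator : Bool → ℕ
indicator b = if b then 1 else 0

indicator-mono : ∀ {a b} → (a ≡ true → b ≡ true) → indicator a ≤ indicator b
indicator-mono {false} _ = z≤n
indicator-mono {true}  h rewrite h refl = ≤-refl

count-mono : ∀ {n} {p q : Fin n → Bool} →
  (∀ u → p u ≡ true → q u ≡ true) → count p ≤ count q
count-mono {zero}  _   = z≤n
count-mono {suc n} p⊆q =
  +-mono-≤ (indicator-mono (p⊆q zero)) (count-mono (p⊆q ∘ suc))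

count-mono-< : ∀ {n} {p q : Fin n → Bool} → (∀ u → p u ≡ true → q u ≡ true) →
  ∀ w → q w ≡ true → p w ≡ false → count p < count q
count-mono-< p⊆q zero qw pw rewrite qw | pw = s≤s (count-mono (p⊆q ∘ suc))
count-mono-< p⊆q (suc w) qw pw =
  +-mono-≤-< (indicator-mono (p⊆q zero)) (count-mono-< (p⊆q ∘ suc) w qw pw)

count-const-true : ∀ n → count {n} (λ _ → true) ≡ n
count-const-true zero    = refl
count-const-true (suc n) = cong suc (count-const-true n)

count<n : ∀ {n} (p : Fin n → Bool) w → p w ≡ false → count p < n
count<n {n} p w pw =
  subst (count p <_) (count-const-true n) (count-mono-< (λ _ _ → refl) w refl pw)

count-∨ : ∀ {n} (p q : Fin n → Bool) → (∀ u → p u ≡ true → q u ≡ false) →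
  count (λ u → p u ∨ q u) ≡ count p + count q
count-∨ {zero}  p q disjoint = refl
count-∨ {suc n} p q disjoint with p zero in p0 | q zero in q0
... | true  | true  = ⊥-elim (true≢false (trans (sym q0) (disjoint zero p0)))
... | true  | false = cong suc (count-∨ (p ∘ suc) (q ∘ suc) (disjoint ∘ suc))
... | false | true  = trans (cong suc (count-∨ (p ∘ suc) (q ∘ suc) (disjoint ∘ suc)))
                           (sym (+-suc _ _))
... | false | false = count-∨ (p ∘ suc) (q ∘ suc) (disjoint ∘ suc)

count>0⇒∃ : ∀ {n} (p : Fin n → Bool) → 0 < count p → ∃ λ u → p u ≡ true
count>0⇒∃ {suc n} p c with p zero in p0
... | true  = zero , p0
... | false = let u , pu = count>0⇒∃ (p ∘ suc) c in suc u , pu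

count>1⇒∃₂ : ∀ {n} (p : Fin n → Bool) → 1 < count p →
  ∃₂ λ u w → u ≢ w × p u ≡ true × p w ≡ true
count>1⇒∃₂ {suc n} p c with p zero in p0
... | true  = let u , pu = count>0⇒∃ (p ∘ suc) (s≤s⁻¹ c)
              in zero , suc u , (λ ()) , p0 , pu
... | false = let u , w , u≢w , pu , pw = count>1⇒∃₂ (p ∘ suc) c
              in suc u , suc w , u≢w ∘ suc-injective , pu , pw

outdeg+indeg<n : ∀ {n} {E : Digraph n} → Oriented E → ∀ v → outdeg E v + indeg E v < n
outdeg+indeg<n {E = E} (loopless , antisymmetric) v =
  subst (_< _) (count-∨ (E v) (λ u → E u v) (λ u → antisymmetric v u))
    (count<n (λ u → E v u ∨ E u v) v (cong₂ _∨_ (loopless v) (loopless v)))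

Path≤2 : ∀ {n} → Digraph n → Fin n → Fin n → Set
Path≤2 E u w = E u w ≡ true ⊎ ∃[ z ] (E u z ≡ true × E z w ≡ true)

Linked≤2 : ∀ {n} → Digraph n → Fin n → Fin n → Set
Linked≤2 E u w = Path≤2 E u w ⊎ Path≤2 E w u

path≤2? : ∀ {n} (E : Digraph n) u w → Dec (Path≤2 E u w)
path≤2? E u w =
  (E u w Bool.≟ true) ⊎-dec any? (λ z → (E u z Bool.≟ true) ×-dec (E z w Bool.≟ true))

linked≤2? : ∀ {n} (E : Digraph n) u w → Dec (Linked≤2 E u w)
linked≤2? E u w = path≤2? E u w ⊎-dec path≤2? E w u

oriented? : ∀ {n} (E : Digraph n) → Dec (Oriented E)
oriented? E = all? (λ u → E u u Bool.≟ false)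
        ×-dec all? (λ u → all? λ w → (E u w Bool.≟ true) →-dec (E w u Bool.≟ false))

Path≤2⇒≢ : ∀ {n} {E : Digraph n} → Oriented E → ∀ {u w} → Path≤2 E u w → u ≢ w
Path≤2⇒≢ (loopless , _) {u} (inj₁ uu) refl = true≢false (trans (sym uu) (loopless u))
Path≤2⇒≢ (_ , antisymmetric) (inj₂ (z , uz , zu)) refl =
  true≢false (trans (sym zu) (antisymmetric _ z uz))

Linked≤2⇒≢ : ∀ {n} {E : Digraph n} → Oriented E → ∀ {u w} → Linked≤2 E u w → u ≢ w
Linked≤2⇒≢ oriented (inj₁ path) = Path≤2⇒≢ oriented path
Linked≤2⇒≢ oriented (inj₂ path) = Path≤2⇒≢ oriented path ∘ sym

EdgePreserving : ∀ {h n} → Digraph h → Digraph n → (Fin h → Fin n) → Set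
EdgePreserving H G f = ∀ u w → H u w ≡ true → G (f u) (f w) ≡ true

Path≤2-map : ∀ {h n} {H : Digraph h} {G : Digraph n} {f} → EdgePreserving H G f →
  ∀ {u w} → Path≤2 H u w → Path≤2 G (f u) (f w)
Path≤2-map hom (inj₁ uw)             = inj₁ (hom _ _ uw)
Path≤2-map hom (inj₂ (z , uz , zw)) = inj₂ (_ , hom _ z uz , hom z _ zw)

Linked≤2-map : ∀ {h n} {H : Digraph h} {G : Digraph n} {f} → EdgePreserving H G f →
  ∀ {u w} → Linked≤2 H u w → Linked≤2 G (f u) (f w)
Linked≤2-map {G = G} hom (inj₁ path) = inj₁ (Path≤2-map {G = G} hom path)
Linked≤2-map {G = G} hom (inj₂ path) = inj₂ (Path≤2-map {G = G} hom path)

edgePreserving⇒injective : ∀ {h n} {H : Digraph h} {G : Digraph n} → Oriented G →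
  (∀ u w → u ≢ w → Linked≤2 H u w) →
  ∀ f → EdgePreserving H G f → Injective _≡_ _≡_ f
edgePreserving⇒injective {G = G} oriented linked f hom {u} {w} fu≡fw with u ≟ w
... | yes u≡w = u≡w
... | no  u≢w =
  ⊥-elim (Linked≤2⇒≢ oriented (Linked≤2-map {G = G} hom (linked u w u≢w)) fu≡fw)

fromEdges : ∀ {n} → List (Fin n × Fin n) → Digraph n
fromEdges []             u w = false
fromEdges ((a , b) ∷ es) u w = (⌊ a ≟ u ⌋ ∧ ⌊ b ≟ w ⌋) ∨ fromEdges es u w

EdgesPreserved : ∀ {h n} → List (Fin h × Fin h) → Digraph n → (Fin h → Fin n) → Set
EdgesPreserved es G f = All (λ (a , b) → G (f a) (f b) ≡ true) es

fromEdges-preserving : ∀ {h n} {G : Digraph n} {es : List (Fin h × Fin h)} f →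
  EdgesPreserved es G f → EdgePreserving (fromEdges es) G f
fromEdges-preserving {G = G} {(a , b) ∷ es} f (fab ∷ rest) u w e with a ≟ u | b ≟ w
... | yes refl | yes refl = fab
... | yes _    | no _     = fromEdges-preserving {G = G} f rest u w e
... | no _     | _        = fromEdges-preserving {G = G} f rest u w e

fromEdges-⊆G : ∀ {h n} {G : Digraph n} {es : List (Fin h × Fin h)} → Oriented G →
  (∀ u w → u ≢ w → Linked≤2 (fromEdges es) u w) →
  ∀ f → EdgesPreserved es G f → fromEdges es ⊆G G
fromEdges-⊆G {G = G} oriented linked f preserved =
  f , edgePreserving⇒injective oriented linked f hom , hom
  where hom = fromEdges-preserving {G = G} f preserved

next3-no-fixpoint : ∀ p → next3 p ≢ p
next3-no-fixpoint 0F ()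
next3-no-fixpoint 1F ()
next3-no-fixpoint 2F ()

next3²-no-fixpoint : ∀ p → next3 (next3 p) ≢ p
next3²-no-fixpoint 0F ()
next3²-no-fixpoint 1F ()
next3²-no-fixpoint 2F ()

lt?⇒< : ∀ i j → lt? i j ≡ true → i < j
lt?⇒< zero    (suc j) _ = s≤s z≤n
lt?⇒< (suc i) (suc j) e = s≤s (lt?⇒< i j e)

DStep : Fin 3 → ℕ → Fin 3 → ℕ → Set
DStep p i q j = (q ≡ p × i < j) ⊎ q ≡ next3 p

DStep-rule : ∀ p q {i j} →
  (if eq3 p q then lt? i j else eq3 (next3 p) q) ≡ true → DStep p i q j
DStep-rule 0F 0F e = inj₁ (refl , lt?⇒< _ _ e)
DStep-rule 0F 1F _ = inj₂ refl
DStep-rule 0F 2F ()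
DStep-rule 1F 0F ()
DStep-rule 1F 1F e = inj₁ (refl , lt?⇒< _ _ e)
DStep-rule 1F 2F _ = inj₂ refl
DStep-rule 2F 0F _ = inj₂ refl
DStep-rule 2F 1F ()
DStep-rule 2F 2F e = inj₁ (refl , lt?⇒< _ _ e)

cyclic-DSteps-advance : ∀ {p q r i j l} →
  DStep p i q j → DStep q j r l → DStep r l p i → q ≡ next3 p
cyclic-DSteps-advance (inj₂ q≡p+1) _ _ = q≡p+1
cyclic-DSteps-advance (inj₁ (refl , i<j)) (inj₁ (refl , j<l)) (inj₁ (_ , l<i)) =
  ⊥-elim (<-asym i<j (<-trans j<l l<i))
cyclic-DSteps-advance {p = p} (inj₁ (refl , _)) (inj₁ (refl , _)) (inj₂ p≡p+1) =
  ⊥-elim (next3-no-fixpoint p (sym p≡p+1))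
cyclic-DSteps-advance {p = p} (inj₁ (refl , _)) (inj₂ refl) (inj₁ (p≡p+1 , _)) =
  ⊥-elim (next3-no-fixpoint p (sym p≡p+1))
cyclic-DSteps-advance {p = p} (inj₁ (refl , _)) (inj₂ refl) (inj₂ p≡p+2) =
  ⊥-elim (next3²-no-fixpoint p (sym p≡p+2))

DStep-two-ahead : ∀ {p q r i l} → q ≡ next3 p → r ≡ next3 q → ¬ DStep p i r l
DStep-two-ahead {p} refl refl (inj₁ (p+2≡p , _)) = next3²-no-fixpoint p p+2≡p
DStep-two-ahead {p} refl refl (inj₂ p+2≡p+1)     = next3-no-fixpoint (next3 p) p+2≡p+1

module _ (s : ℕ) where

  part : Fin (3 * s) → Fin 3
  part x = proj₁ (remQuot {3} s x)

  index : Fin (3 * s) → ℕ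
  index x = toℕ (proj₂ (remQuot {3} s x))

  D-step : ∀ {x y} → D s x y ≡ true → DStep (part x) (index x) (part y) (index y)
  D-step {x} {y} = DStep-rule (part x) (part y)

  D-cyclic-triangle-advances : ∀ {x y z} →
    D s x y ≡ true → D s y z ≡ true → D s z x ≡ true → part y ≡ next3 (part x)
  D-cyclic-triangle-advances xy yz zx =
    cyclic-DSteps-advance (D-step xy) (D-step yz) (D-step zx)

minFin-≤ : ∀ {m} (f : Fin (suc m) → ℕ) i → minFin f ≤ f i
minFin-≤ {zero}  f zero    = ≤-refl
minFin-≤ {suc m} f zero    = m⊓n≤m _ _
minFin-≤ {suc m} f (suc i) = ≤-trans (m⊓n≤n (f zero) _) (minFin-≤ (f ∘ suc) i)

δ⁰≤outdeg : ∀ {n} (E : Digraph n) v → δ⁰ E ≤ outdeg E v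
δ⁰≤outdeg {suc m} E v = ≤-trans (minFin-≤ _ v) (m⊓n≤m _ _)

δ⁰≤indeg : ∀ {n} (E : Digraph n) v → δ⁰ E ≤ indeg E v
δ⁰≤indeg {suc m} E v = ≤-trans (minFin-≤ _ v) (m⊓n≤n _ _)

EveryEdgeInCyclicTriangle : ∀ {n} → Digraph n → Set
EveryEdgeInCyclicTriangle G =
  ∀ {u w} → G u w ≡ true → ∃[ z ] (G w z ≡ true × G z u ≡ true)

regular⇒everyEdgeInCyclicTriangle : ∀ {k} {G : Digraph (suc (k + k))} →
  Tournament G → k ≤ δ⁰ G → EveryEdgeInCyclicTriangle G
regular⇒everyEdgeInCyclicTriangle {k} {G}
  (oriented@(loopless , antisymmetric) , total) k≤δ⁰ {u} {w} uw
  with any? (λ z → (G w z Bool.≟ true) ×-dec (G z u Bool.≟ true))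
... | yes triangle = triangle
... | no  no-triangle = ⊥-elim (≤⇒≯ 1+2k≤degrees (outdeg+indeg<n oriented w))
  where
  in-u⊆in-w : ∀ z → G z u ≡ true → G z w ≡ true
  in-u⊆in-w z zu
    with total z w (λ { refl → true≢false (trans (sym zu) (antisymmetric u w uw)) })
  ... | inj₁ zw = zw
  ... | inj₂ wz = ⊥-elim (no-triangle (z , wz , zu))

  k<indeg-w : k < indeg G w
  k<indeg-w = ≤-<-trans (≤-trans k≤δ⁰ (δ⁰≤indeg G u))
                        (count-mono-< in-u⊆in-w u uw (loopless u))

  1+2k≤degrees : suc (k + k) ≤ outdeg G w + indeg G w
  1+2k≤degrees = subst (_≤ outdeg G w + indeg G w) (+-suc k k)
    (+-mono-≤ (≤-trans k≤δ⁰ (δ⁰≤outdeg G w)) k<indeg-w)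

transitive-triangle : ∀ {n} {G : Digraph n} → Tournament G → ∀ a → 1 < outdeg G a →
  ∃₂ λ v x → G a v ≡ true × G a x ≡ true × G v x ≡ true
transitive-triangle {G = G} (_ , total) a 1<outdeg with count>1⇒∃₂ (G a) 1<outdeg
... | v , x , v≢x , av , ax with total v x v≢x
...   | inj₁ vx = v , x , av , ax , vx
...   | inj₂ xv = x , v , ax , av , xv

H : Digraph 5
H = fromEdges ((0F , 1F) ∷ (1F , 2F) ∷ (0F , 2F) ∷
               (1F , 4F) ∷ (4F , 0F) ∷ (2F , 3F) ∷ (3F , 1F) ∷ [])

H-oriented : Oriented H
H-oriented = from-yes (oriented? H)

H-linked≤2 : ∀ u w → u ≢ w → Linked≤2 H u w
H-linked≤2 = from-yes (all? λ u → all? λ w → ¬? (u ≟ w) →-dec linked≤2? H u w)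

H⊄D : ∀ s → ¬ (H ⊆G D s)
H⊄D s (_ , _ , hom) = DStep-two-ahead
  (D-cyclic-triangle-advances s (hom 0F 1F refl) (hom 1F 4F refl) (hom 4F 0F refl))
  (D-cyclic-triangle-advances s (hom 1F 2F refl) (hom 2F 3F refl) (hom 3F 1F refl))
  (D-step s (hom 0F 2F refl))

H⊆G : ∀ {n} {G : Digraph n} → Oriented G → EveryEdgeInCyclicTriangle G →
  ∀ {a v x} → G a v ≡ true → G a x ≡ true → G v x ≡ true → H ⊆G G
H⊆G {G = G} oriented cyclic {a} {v} {x} av ax vx with cyclic vx | cyclic av
... | y , xy , yv | z , vz , za =
  fromEdges-⊆G {G = G} oriented H-linked≤2
    (λ { 0F → a ; 1F → v ; 2F → x ; 3F → y ; 4F → z })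
    (av ∷ vx ∷ ax ∷ vz ∷ za ∷ xy ∷ yv ∷ [])

regular⇒H⊆G : ∀ {k} {G : Digraph (suc (k + k))} →
  Tournament G → 1 < k → k ≤ δ⁰ G → H ⊆G G
regular⇒H⊆G {G = G} tournament 1<k k≤δ⁰ =
  let v , x , av , ax , vx = transitive-triangle tournament zero
                               (≤-trans 1<k (≤-trans k≤δ⁰ (δ⁰≤outdeg G zero)))
  in H⊆G (proj₁ tournament) (regular⇒everyEdgeInCyclicTriangle tournament k≤δ⁰)
         av ax vx

5≤1+2k⇒1<k : ∀ k → 5 ≤ suc (k + k) → 1 < k
5≤1+2k⇒1<k 0             (s≤s ())
5≤1+2k⇒1<k 1             (s≤s (s≤s (s≤s ())))
5≤1+2k⇒1<k (suc (suc k)) _ = s≤s (s≤s z≤n)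

H-turanable : Turanable H
H-turanable = 5 , λ where
  _ 5≤n G (tournament , k , refl , δ⁰≡k) →
    regular⇒H⊆G tournament (5≤1+2k⇒1<k k 5≤n) (≤-reflexive (sym δ⁰≡k))

theorem1p6 : ∃[ h ] Σ (Digraph h) λ H →
    Oriented H × Turanable H × (∀ (s : ℕ) → 1 ≤ s → ¬ (H ⊆G D s))
theorem1p6 = 5 , H , H-oriented , H-turanable , λ s _ → H⊄D s
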